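{- The integer linear program $\mathcal{E}(G)$ has a tighter linear relaxation than $\mathcal{N}_2(G)$: for every graph $G=(V,E)$, the projection onto the $x$-variables of the linear relaxation of $\mathcal{E}(G)$ is contained in the linear relaxation of $\mathcal{N}_2(G)$ (so for every weight vector $w$ its optimal relaxation value is at most that of $\mathcal{N}_2(G)$), and there exists a graph for which this containment is strict.
   Context: For a graph $G=(V,E)$ and weights $w\in\mathbb{R}^V$, both programs solve the maximum $w$-weighted co-2-plex problem (a co-2-plex is a vertex set inducing a subgraph of maximum degree at most $1$). $\mathcal{N}_2(G)=\max\{w^\top x: x\in\{0,1\}^V,\ x(N(u))+(|N(u)|-1)x_u\le|N(u)|\ \forall u\in V\}$, where $N(u)$ is the neighbourhood of $u$ and $x(S)=\sum_{s\in S}x_s$. $\mathcal{E}(G)=\max\{w^\top x: (x,y)\in\{0,1\}^V\times\{0,1\}^E,\ y(\delta(v))\le x_v\ \forall v\in V,\ y_e\ge0\ \forall e\in E,\ x_u+x_v-y_{uv}\le1\ \forall uv\in E\}$, where $\delta(v)$ is the set of edges incident to $v$. The linear relaxation of a program is obtained by replacing $\{0,1\}$ by $[0,1]$.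
   Formalization: The variables x and y and the weights w take values in ℚ rather than ℝ, so the linear relaxations of both programs and the projection are taken over ℚ. -}

module Defs where

open import Data.Nat using (ℕ; zero; suc)
open import Data.Bool using (Bool; true; false; if_then_else_)
open import Data.Fin using (Fin; _<_)
open import Data.Integer using (+_)
open import Data.Rational using (ℚ; 0ℚ; 1ℚ; _+_; _-_; _*_; _≤_; _/_)
open import Data.Product using (Σ; _×_; ∃)
open import Relation.Binary.PropositionalEquality using (_≡_)

record Graph : Set where
  field
    n     : ℕ
    adj   : Fin n → Fin n → Bool
    sym   : ∀ u v → adj u v ≡ adj v u
    irref : ∀ v → adj v v ≡ false
open Graph public

VVec : Graph → Set
VVec G = Fin (n G) → ℚ

-- Edge vectors (y ∈ ℚ^E), represented as symmetric functions on ordered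
-- pairs that vanish on non-edges; such functions correspond bijectively
-- to functions E → ℚ (y_{uv} is the value on the edge {u,v}).
EVec : Graph → Set
EVec G = Fin (n G) → Fin (n G) → ℚ

IsEdgeVector : (G : Graph) → EVec G → Set
IsEdgeVector G y =
  (∀ u v → y u v ≡ y v u) × (∀ u v → adj G u v ≡ false → y u v ≡ 0ℚ)

∑ : (m : ℕ) → (Fin m → ℚ) → ℚ
∑ zero    f = 0ℚ
∑ (suc m) f = f Fin.zero + ∑ m (λ i → f (Fin.suc i))
  where import Data.Fin as Fin

sumN : (G : Graph) → VVec G → Fin (n G) → ℚ
sumN G x u = ∑ (n G) (λ w → if adj G u w then x w else 0ℚ)

deg : (G : Graph) → Fin (n G) → ℚ
deg G u = ∑ (n G) (λ w → if adj G u w then 1ℚ else 0ℚ)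

sumδ : (G : Graph) → EVec G → Fin (n G) → ℚ
sumδ G y v = ∑ (n G) (λ w → if adj G v w then y v w else 0ℚ)

InN2Relax : (G : Graph) → VVec G → Set
InN2Relax G x =
  (∀ v → 0ℚ ≤ x v) × (∀ v → x v ≤ 1ℚ) ×
  (∀ u → sumN G x u + (deg G u - 1ℚ) * x u ≤ deg G u)

InERelax : (G : Graph) → VVec G → EVec G → Set
InERelax G x y =
  IsEdgeVector G y ×
  (∀ v → 0ℚ ≤ x v) × (∀ v → x v ≤ 1ℚ) ×
  (∀ u v → adj G u v ≡ true → 0ℚ ≤ y u v) ×
  (∀ u v → adj G u v ≡ true → y u v ≤ 1ℚ) ×
  (∀ v → sumδ G y v ≤ x v) ×
  (∀ u v → adj G u v ≡ true → x u + x v - y u v ≤ 1ℚ)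

InProjERelax : (G : Graph) → VVec G → Set
InProjERelax G x = Σ (EVec G) (λ y → InERelax G x y)

dot : (G : Graph) → VVec G → VVec G → ℚ
dot G w x = ∑ (n G) (λ v → w v * x v)

{-# OPTIONS --safe #-}
-- Summing the edge inequalities x_u + x_w − 1 ≤ y_uw (and y_uw ≥ 0) over the
-- neighbours w of u and using y(δ(u)) ≤ x_u shows that every point of the
-- projected relaxation of E(G) satisfies
--   Σ_{w ∈ N(u)} max(0, x_u + x_w − 1) ≤ x_u.
-- Dropping the max gives x(N(u)) + |N(u)|(x_u − 1) ≤ x_u, a rearrangement of
-- the N₂ inequality at u.  On the star K₁,₃ the point with centre ½ and leaves
-- 1, 1, 0 satisfies every N₂ inequality but violates the bound at the centre.
module Submission where

open import Defs
open import Data.Bool using (Bool; true; false; if_then_else_; _xor_)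
open import Data.Bool.Properties using (xor-comm; xor-same)
open import Data.Fin using (Fin; zero; suc)
open import Data.Fin.Properties using (all?)
import Data.Nat as ℕ
open import Data.Product using (Σ; _×_; _,_)
open import Data.Rational using (ℚ; 0ℚ; 1ℚ; ½; _+_; _-_; _*_; _≤_; _⊔_; _≤?_; _<?_)
open import Data.Rational.Properties
  using (≤-refl; ≤-reflexive; ≤-trans; <-≤-trans; <-irrefl; +-mono-≤; +-monoˡ-≤; *-distribʳ-+; *-zeroˡ; p≤p⊔q; ⊔-lub; module ≤-Reasoning)
open import Data.Rational.Solver using (module +-*-Solver)
open import Data.Vec using (_∷_; []; lookup)
open import Relation.Binary.PropositionalEquality using (_≡_; refl; trans; cong; subst₂)
  renaming (sym to ≡-sym)
open import Relation.Nullary using (¬_)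
open import Relation.Nullary.Decidable using (from-yes)

open +-*-Solver

∑-+ : ∀ m (f g : Fin m → ℚ) → ∑ m (λ i → f i + g i) ≡ ∑ m f + ∑ m g
∑-+ ℕ.zero    f g = refl
∑-+ (ℕ.suc m) f g =
  trans (cong (f zero + g zero +_) (∑-+ m (λ i → f (suc i)) (λ i → g (suc i))))
        (solve 4 (λ a b c d → (a :+ b) :+ (c :+ d) := (a :+ c) :+ (b :+ d)) refl
               (f zero) (g zero) (∑ m (λ i → f (suc i))) (∑ m (λ i → g (suc i))))

∑-*ʳ : ∀ m (f : Fin m → ℚ) c → ∑ m (λ i → f i * c) ≡ ∑ m f * c
∑-*ʳ ℕ.zero    f c = ≡-sym (*-zeroˡ c)
∑-*ʳ (ℕ.suc m) f c =
  trans (cong (f zero * c +_) (∑-*ʳ m (λ i → f (suc i)) c))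
        (≡-sym (*-distribʳ-+ c (f zero) _))

∑-mono-≤ : ∀ m {f g : Fin m → ℚ} → (∀ i → f i ≤ g i) → ∑ m f ≤ ∑ m g
∑-mono-≤ ℕ.zero    f≤g = ≤-refl
∑-mono-≤ (ℕ.suc m) f≤g = +-mono-≤ (f≤g zero) (∑-mono-≤ m (λ i → f≤g (suc i)))

p-y≤1⇒p-1≤y : ∀ {p y} → p - y ≤ 1ℚ → p - 1ℚ ≤ y
p-y≤1⇒p-1≤y {p} {y} p-y≤1 = subst₂ _≤_
  (solve 2 (λ p y → (p :- y) :+ (y :- con 1ℚ) := p :- con 1ℚ) refl p y)
  (solve 1 (λ y → con 1ℚ :+ (y :- con 1ℚ) := y) refl y)
  (+-monoˡ-≤ (y - 1ℚ) p-y≤1)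

excessSum : (G : Graph) → VVec G → Fin (n G) → ℚ
excessSum G x u = ∑ (n G) (λ w → if adj G u w then (x u + x w - 1ℚ) ⊔ 0ℚ else 0ℚ)

excessSum≤ : ∀ G x {y} → InERelax G x y → ∀ u → excessSum G x u ≤ x u
excessSum≤ G x {y} (_ , _ , _ , y≥0 , _ , δ≤x , edge) u =
  ≤-trans (∑-mono-≤ (n G) excess≤y) (δ≤x u)
  where
  excess≤y : ∀ w → (if adj G u w then (x u + x w - 1ℚ) ⊔ 0ℚ else 0ℚ)
                 ≤ (if adj G u w then y u w else 0ℚ)
  excess≤y w with adj G u w in uw
  ... | true  = ⊔-lub (p-y≤1⇒p-1≤y {x u + x w} (edge u w uw)) (y≥0 u w uw)
  ... | false = ≤-refl

neighbourTerm≤excess : ∀ b a p →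
  (if b then p else 0ℚ) + (if b then 1ℚ else 0ℚ) * (a - 1ℚ) ≤ (if b then (a + p - 1ℚ) ⊔ 0ℚ else 0ℚ)
neighbourTerm≤excess true  a p = ≤-trans
  (≤-reflexive (solve 2 (λ a p → p :+ con 1ℚ :* (a :- con 1ℚ) := a :+ p :- con 1ℚ) refl a p))
  (p≤p⊔q _ _)
neighbourTerm≤excess false a p =
  ≤-reflexive (solve 1 (λ a → con 0ℚ :+ con 0ℚ :* (a :- con 1ℚ) := con 0ℚ) refl a)

sumN+deg*[x-1]≤excessSum : ∀ G x u → sumN G x u + deg G u * (x u - 1ℚ) ≤ excessSum G x u
sumN+deg*[x-1]≤excessSum G x u = begin
  sumN G x u + deg G u * (x u - 1ℚ)
    ≡⟨ ≡-sym (trans (∑-+ (n G) X (λ w → A w * (x u - 1ℚ)))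
                    (cong (sumN G x u +_) (∑-*ʳ (n G) A (x u - 1ℚ)))) ⟩
  ∑ (n G) (λ w → X w + A w * (x u - 1ℚ))
    ≤⟨ ∑-mono-≤ (n G) (λ w → neighbourTerm≤excess (adj G u w) (x u) (x w)) ⟩
  excessSum G x u ∎
  where
  open ≤-Reasoning
  X A : Fin (n G) → ℚ
  X w = if adj G u w then x w else 0ℚ
  A w = if adj G u w then 1ℚ else 0ℚ

s+d*[a-1]≤a⇒s+[d-1]*a≤d : ∀ s d a → s + d * (a - 1ℚ) ≤ a → s + (d - 1ℚ) * a ≤ d
s+d*[a-1]≤a⇒s+[d-1]*a≤d s d a h = subst₂ _≤_
  (solve 3 (λ s d a → (s :+ d :* (a :- con 1ℚ)) :+ (d :- a) := s :+ (d :- con 1ℚ) :* a) refl s d a)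
  (solve 2 (λ d a → a :+ (d :- a) := d) refl d a)
  (+-monoˡ-≤ (d - a) h)

projERelax⊆N2Relax : ∀ G x → InProjERelax G x → InN2Relax G x
projERelax⊆N2Relax G x (y , e@(_ , x≥0 , x≤1 , _)) = x≥0 , x≤1 , λ u →
  s+d*[a-1]≤a⇒s+[d-1]*a≤d (sumN G x u) (deg G u) (x u) (≤-trans (sumN+deg*[x-1]≤excessSum G x u) (excessSum≤ G x e u))

isCentre : ∀ {k} → Fin k → Bool
isCentre zero    = true
isCentre (suc _) = false

star : ℕ.ℕ → Graph
star k = record
  { n     = ℕ.suc k
  ; adj   = λ u v → isCentre u xor isCentre v
  ; sym   = λ u v → xor-comm (isCentre u) (isCentre v)
  ; irref = λ v → xor-same (isCentre v)
  }

starPoint : VVec (star 3)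
starPoint = lookup (½ ∷ 1ℚ ∷ 1ℚ ∷ 0ℚ ∷ [])

starPoint∈N2Relax : InN2Relax (star 3) starPoint
starPoint∈N2Relax =
  from-yes (all? λ v → 0ℚ ≤? starPoint v) ,
  from-yes (all? λ v → starPoint v ≤? 1ℚ) ,
  from-yes (all? λ u → sumN (star 3) starPoint u + (deg (star 3) u - 1ℚ) * starPoint u
                         ≤? deg (star 3) u)

starPoint∉projERelax : ¬ InProjERelax (star 3) starPoint
starPoint∉projERelax (_ , e) =
  <-irrefl refl (<-≤-trans (from-yes (starPoint zero <? excessSum (star 3) starPoint zero))
                           (excessSum≤ (star 3) starPoint e zero))

corollary6 : ((G : Graph) → (x : VVec G) → InProjERelax G x → InN2Relax G x)
    × ((G : Graph) → (w : VVec G) → (x : VVec G) → InProjERelax G x →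
         Σ (VVec G) (λ x′ → InN2Relax G x′ × dot G w x ≤ dot G w x′))
    × Σ Graph (λ G → Σ (VVec G) (λ x → InN2Relax G x × ¬ InProjERelax G x))
corollary6 =
  projERelax⊆N2Relax ,
  (λ G w x x∈projE → x , projERelax⊆N2Relax G x x∈projE , ≤-refl) ,
  star 3 , starPoint , starPoint∈N2Relax , starPoint∉projERelax
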